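{- Let $0<m<M$, let $r>0$, and let $\mathrm{ORA}_r$ be the algorithm which, given prediction $p\in[m,M]$, accepts the first revealed price that is at least $r\cdot p$ (and, if no such price appears, accepts the last price by default). Then for every input with prediction $p$ and price sequence $\sigma$, the ratio $p^*/\mathrm{ORA}_r(\sigma)$ is at most $(1-\eta)/r$ if the error is negative and $\eta\le 1-r$; $(1-\eta)M/m$ if the error is negative and $\eta>1-r$; $(1+\eta)/r$ if the error is positive and $\eta\ge r-1$; $M/m$ if the error is positive and $\eta<r-1$.
   Context: Online search problem: $0<m<M$ are known bounds. A sequence of prices $\sigma_1,\dots,\sigma_d\in[m,M]$ (with $d\ge1$ unknown to the player) is revealed one per day. When $\sigma_i$ is revealed the player irrevocably either accepts it (its profit is $\sigma_i$) or rejects it; if $\sigma_1,\dots,\sigma_{d-1}$ are all rejected, $\sigma_d$ is accepted by default. $\mathrm{ORA}_r(\sigma)$ denotes the accepted price. Let $p^*=\max_i\sigma_i$. The algorithm receives a prediction $p\in[m,M]$ of $p^*$. If $p^*\le p$ the error is negative and $\eta$ is defined by $1-\eta=p^*/p$; if $p^*>p$ the error is positive and $\eta$ is defined by $1+\eta=p^*/p$.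
   Formalization: The bounds m and M, the parameter r, the prediction p and the prices σᵢ are all taken in the rationals. -}

module Defs where

open import Data.Bool using (if_then_else_)
open import Data.List using (List; []; _∷_)
open import Data.List.NonEmpty using (List⁺; _∷_; foldr₁)
open import Data.Rational
open import Relation.Binary.PropositionalEquality using (_≡_)
open import Relation.Nullary using (yes; no)

-- Total division on ℚ: x ⊘ y = x / y when y ≠ 0 (and 0 otherwise; this
-- junk value is never used in the theorem since all divisors are > 0).
_⊘_ : ℚ → ℚ → ℚ
x ⊘ y with y ≟ 0ℚ
... | yes _ = 0ℚ
... | no y≢0 = _÷_ x y {{≢-nonZero y≢0}}

infixl 7 _⊘_

PriceSeq : Set
PriceSeq = List⁺ ℚ

pStar : PriceSeq → ℚ
pStar σ = foldr₁ _⊔_ σ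

oraAux : ℚ → ℚ → List ℚ → ℚ
oraAux t x []       = x
oraAux t x (y ∷ ys) = if t ≤ᵇ x then x else oraAux t y ys

ORA : (r p : ℚ) → PriceSeq → ℚ
ORA r p (x ∷ xs) = oraAux (r * p) x xs

ηNeg : (pstar p : ℚ) → ℚ
ηNeg pstar p = 1ℚ - pstar ⊘ p

ηPos : (pstar p : ℚ) → ℚ
ηPos pstar p = pstar ⊘ p - 1ℚ

{-# OPTIONS --safe #-}
-- Both p* and the accepted price are prices, so they lie in [m, M]; this alone gives
-- the bounds (1 - η)M/m = (p*/p)·M/m (using p ≤ M) and M/m. The hypotheses of the
-- other two bounds both say r ≤ p*/p, i.e. r·p ≤ p*: then some price reaches the
-- threshold r·p, so the accepted price is at least r·p and
-- p*/ORA ≤ p*/(r·p) = (p*/p)/r, which is (1 - η)/r resp. (1 + η)/r.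
module Submission where

open import Defs
open import Data.Bool using (T; true; false)
open import Data.List using ([]; _∷_)
open import Data.List.NonEmpty using (_∷_; toList)
open import Data.List.Relation.Unary.All using (All; []; _∷_)
open import Data.Product using (_×_; _,_; proj₁; proj₂)
open import Data.Rational
open import Data.Rational.Properties
open import Data.Rational.Solver using (module +-*-Solver)
open import Data.Sum using (inj₁; inj₂)
open import Data.Unit using (tt)
open import Relation.Binary.PropositionalEquality
open import Relation.Nullary using (yes; no; contradiction)
open import Algebra.Properties.Group +-0-group using (//-rightDividesʳ; ⁻¹-involutive)

private
  variable
    x y z : ℚ

+-cancelʳ-≤ : ∀ z → x + z ≤ y + z → x ≤ y
+-cancelʳ-≤ {x} {y} z x+z≤y+z =
  subst₂ _≤_ (//-rightDividesʳ z x) (//-rightDividesʳ z y) (+-monoˡ-≤ (- z) x+z≤y+z)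

+-cancelˡ-≤ : ∀ z → z + x ≤ z + y → x ≤ y
+-cancelˡ-≤ {x} {y} z z+x≤z+y = +-cancelʳ-≤ z (subst₂ _≤_ (+-comm z x) (+-comm z y) z+x≤z+y)

neg-cancel-≤ : - x ≤ - y → y ≤ x
neg-cancel-≤ {x} {y} -x≤-y = subst₂ _≤_ (⁻¹-involutive y) (⁻¹-involutive x) (neg-antimono-≤ -x≤-y)

1-[1-x]≡x : ∀ x → 1ℚ - (1ℚ - x) ≡ x
1-[1-x]≡x = solve 1 (λ x → con 1ℚ :- (con 1ℚ :- x) := x) refl
  where open +-*-Solver

1+[x-1]≡x : ∀ x → 1ℚ + (x - 1ℚ) ≡ x
1+[x-1]≡x = solve 1 (λ x → con 1ℚ :+ (x :- con 1ℚ) := x) refl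
  where open +-*-Solver

÷-*-cancel : ∀ x y .{{_ : NonZero y}} → x ÷ y * y ≡ x
÷-*-cancel x y = begin
  x * 1/ y * y   ≡⟨ *-assoc x (1/ y) y ⟩
  x * (1/ y * y) ≡⟨ cong (x *_) (*-inverseˡ y) ⟩
  x * 1ℚ         ≡⟨ *-identityʳ x ⟩
  x              ∎
  where open ≡-Reasoning

⊘-*-cancel : y ≢ 0ℚ → (x ⊘ y) * y ≡ x
⊘-*-cancel {y} {x} y≢0 with y ≟ 0ℚ
... | yes y≡0 = contradiction y≡0 y≢0
... | no  y≢0 = ÷-*-cancel x y {{≢-nonZero y≢0}}

pos⇒≢0 : 0ℚ < y → y ≢ 0ℚ
pos⇒≢0 0<y = ≢-sym (<⇒≢ 0<y)

⊘-nonNeg : 0ℚ ≤ x → 0ℚ < y → 0ℚ ≤ x ⊘ y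
⊘-nonNeg {x} {y} 0≤x 0<y = *-cancelʳ-≤-pos y {{positive 0<y}}
  (subst₂ _≤_ (sym (*-zeroˡ y)) (sym (⊘-*-cancel (pos⇒≢0 0<y))) 0≤x)

≤*⇒⊘≤ : 0ℚ < y → x ≤ z * y → x ⊘ y ≤ z
≤*⇒⊘≤ {y} 0<y x≤z*y =
  *-cancelʳ-≤-pos y {{positive 0<y}} (subst (_≤ _) (sym (⊘-*-cancel (pos⇒≢0 0<y))) x≤z*y)

≤⊘⇒*≤ : 0ℚ < y → z ≤ x ⊘ y → z * y ≤ x
≤⊘⇒*≤ {y} 0<y z≤x⊘y =
  subst (_ ≤_) (⊘-*-cancel (pos⇒≢0 0<y)) (*-monoʳ-≤-nonNeg y {{nonNegative (<⇒≤ 0<y)}} z≤x⊘y)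

≤⊘* : 0ℚ ≤ x → 0ℚ < y → y ≤ z → x ≤ x ⊘ y * z
≤⊘* {x} {y} {z} 0≤x 0<y y≤z = begin
  x         ≡⟨ ⊘-*-cancel (pos⇒≢0 0<y) ⟨
  x ⊘ y * y ≤⟨ *-monoˡ-≤-nonNeg (x ⊘ y) {{nonNegative (⊘-nonNeg 0≤x 0<y)}} y≤z ⟩
  x ⊘ y * z ∎
  where open ≤-Reasoning

⊘-mono-≤ : ∀ {x′ y′} → 0ℚ ≤ x → x ≤ x′ → 0ℚ < y′ → y′ ≤ y → x ⊘ y ≤ x′ ⊘ y′
⊘-mono-≤ 0≤x x≤x′ 0<y′ y′≤y = ≤*⇒⊘≤ (<-≤-trans 0<y′ y′≤y)
  (≤-trans x≤x′ (≤⊘* (≤-trans 0≤x x≤x′) 0<y′ y′≤y))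

⊘-≤-⊘⊘ : ∀ {w} → 0ℚ ≤ x → 0ℚ < y → 0ℚ < z → z * y ≤ w → x ⊘ w ≤ x ⊘ y ⊘ z
⊘-≤-⊘⊘ {x} {y} {z} {w} 0≤x 0<y 0<z z*y≤w = ≤*⇒⊘≤ 0<w (begin
  x                   ≡⟨ ⊘-*-cancel (pos⇒≢0 0<y) ⟨
  x ⊘ y * y           ≡⟨ cong (_* y) (⊘-*-cancel (pos⇒≢0 0<z)) ⟨
  x ⊘ y ⊘ z * z * y   ≡⟨ *-assoc (x ⊘ y ⊘ z) z y ⟩
  x ⊘ y ⊘ z * (z * y) ≤⟨ *-monoˡ-≤-nonNeg (x ⊘ y ⊘ z) {{nonNegative 0≤x⊘y⊘z}} z*y≤w ⟩
  x ⊘ y ⊘ z * w       ∎)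
  where
  open ≤-Reasoning
  0≤x⊘y⊘z : 0ℚ ≤ x ⊘ y ⊘ z
  0≤x⊘y⊘z = ⊘-nonNeg (⊘-nonNeg 0≤x 0<y) 0<z
  0<w : 0ℚ < w
  0<w = <-≤-trans (positive⁻¹ (z * y) {{pos*pos⇒pos z {{positive 0<z}} y {{positive 0<y}}}}) z*y≤w

x<t⇒t≤x⊔y⇒t≤y : ∀ {t} → x < t → t ≤ x ⊔ y → t ≤ y
x<t⇒t≤x⊔y⇒t≤y {x} {y} x<t t≤x⊔y with ⊔-sel x y
... | inj₁ x⊔y≡x = contradiction (<-≤-trans x<t (subst (_ ≤_) x⊔y≡x t≤x⊔y)) (<-irrefl refl)
... | inj₂ x⊔y≡y = subst (_ ≤_) x⊔y≡y t≤x⊔y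

All⇒pStar : ∀ {P : ℚ → Set} σ → All P (toList σ) → P (pStar σ)
All⇒pStar         (x ∷ [])     (Px ∷ [])  = Px
All⇒pStar {P = P} (x ∷ y ∷ ys) (Px ∷ Pys) with ⊔-sel x (pStar (y ∷ ys))
... | inj₁ x⊔y≡x = subst P (sym x⊔y≡x) Px
... | inj₂ x⊔y≡y = subst P (sym x⊔y≡y) (All⇒pStar (y ∷ ys) Pys)

All⇒oraAux : ∀ {P : ℚ → Set} t x ys → All P (x ∷ ys) → P (oraAux t x ys)
All⇒oraAux t x []       (Px ∷ [])  = Px
All⇒oraAux t x (y ∷ ys) (Px ∷ Pys) with t ≤ᵇ x
... | true  = Px
... | false = All⇒oraAux t y ys Pys

All⇒ORA : ∀ {P : ℚ → Set} r p σ → All P (toList σ) → P (ORA r p σ)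
All⇒ORA r p (x ∷ xs) = All⇒oraAux (r * p) x xs

≤pStar⇒≤oraAux : ∀ t x ys → t ≤ pStar (x ∷ ys) → t ≤ oraAux t x ys
≤pStar⇒≤oraAux t x []       t≤x = t≤x
≤pStar⇒≤oraAux t x (y ∷ ys) t≤pStar with t ≤ᵇ x in t≤ᵇx
... | true  = ≤ᵇ⇒≤ (subst T (sym t≤ᵇx) tt)
... | false = ≤pStar⇒≤oraAux t y ys (x<t⇒t≤x⊔y⇒t≤y x<t t≤pStar)
  where
  x<t : x < t
  x<t = ≰⇒> (λ t≤x → subst T t≤ᵇx (≤⇒≤ᵇ t≤x))

≤pStar⇒≤ORA : ∀ r p σ → r * p ≤ pStar σ → r * p ≤ ORA r p σ
≤pStar⇒≤ORA r p (x ∷ xs) = ≤pStar⇒≤oraAux (r * p) x xs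

theorem2 : (m M r p : ℚ) (σ : PriceSeq) →
    0ℚ < m → m < M → 0ℚ < r →
    m ≤ p → p ≤ M →
    All (λ x → m ≤ x × x ≤ M) (toList σ) →
    ((pStar σ ≤ p → ηNeg (pStar σ) p ≤ 1ℚ - r →
        pStar σ ⊘ ORA r p σ ≤ (1ℚ - ηNeg (pStar σ) p) ⊘ r)
    × (pStar σ ≤ p → 1ℚ - r < ηNeg (pStar σ) p →
        pStar σ ⊘ ORA r p σ ≤ (1ℚ - ηNeg (pStar σ) p) * M ⊘ m)
    × (p < pStar σ → r - 1ℚ ≤ ηPos (pStar σ) p →
        pStar σ ⊘ ORA r p σ ≤ (1ℚ + ηPos (pStar σ) p) ⊘ r)
    × (p < pStar σ → ηPos (pStar σ) p < r - 1ℚ →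
        pStar σ ⊘ ORA r p σ ≤ M ⊘ m))
theorem2 m M r p σ 0<m _ 0<r m≤p p≤M inRange =
    (λ _ η≤1-r → subst (λ c → P ⊘ a ≤ c ⊘ r) (sym (1-[1-x]≡x q))
                   (threshold (neg-cancel-≤ (+-cancelˡ-≤ 1ℚ η≤1-r))))
  , (λ _ _ → subst (λ c → P ⊘ a ≤ c * M ⊘ m) (sym (1-[1-x]≡x q))
                   (⊘-mono-≤ 0≤P (≤⊘* 0≤P 0<p p≤M) 0<m m≤a))
  , (λ _ r-1≤η → subst (λ c → P ⊘ a ≤ c ⊘ r) (sym (1+[x-1]≡x q))
                   (threshold (+-cancelʳ-≤ (- 1ℚ) r-1≤η)))
  , (λ _ _ → ⊘-mono-≤ 0≤P P≤M 0<m m≤a)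
  where
  P a q : ℚ
  P = pStar σ
  a = ORA r p σ
  q = P ⊘ p
  0<p : 0ℚ < p
  0<p = <-≤-trans 0<m m≤p
  0≤P : 0ℚ ≤ P
  0≤P = ≤-trans (<⇒≤ 0<m) (proj₁ (All⇒pStar σ inRange))
  P≤M : P ≤ M
  P≤M = proj₂ (All⇒pStar σ inRange)
  m≤a : m ≤ a
  m≤a = proj₁ (All⇒ORA r p σ inRange)
  threshold : r ≤ q → P ⊘ a ≤ q ⊘ r
  threshold r≤q = ⊘-≤-⊘⊘ 0≤P 0<p 0<r (≤pStar⇒≤ORA r p σ (≤⊘⇒*≤ 0<p r≤q))
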